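{- Consider a stable defeasible logic. Let $C_d$ be the applicability condition of an inference rule $+d$ and $C_\Delta$ the applicability condition of $+\Delta$. If the formula $\forall D\,\forall P\,\forall q\;\big(C_d(q)\wedge C_d({\sim}q)\big)\rightarrow\big(C_\Delta(q)\wedge C_\Delta({\sim}q)\big)$ is proof-valid, then the inference rule $+d$ is consistent.
   Context: Literals are propositions $p$ or their negations; ${\sim}q$ is the complementary literal. A defeasible theory $D=(F,R,>)$ consists of a finite set $F$ of literals, a finite set $R$ of rules (each rule $r$ with a finite antecedent set $A(r)$ of literals, a type strict/defeasible/defeater and a consequent literal) and an acyclic relation $>$ on $R$; $R_s[q]$ denotes the strict rules with consequent $q$. Conclusions have the form $+d\,q$ or $-d\,q$. A defeasible logic is a finite set of inference rules "We may append $\pm d\,q$ to $P$ if $C$", one per tag, with applicability conditions $C(D,q,P)$ (first-order conditions on $D$, the literal $q$ and the sequence $P$ of conclusions so far); a proof from $D$ is a finite sequence of conclusions each appendable by some rule to the sequence preceding it, and $D\vdash c$ ($c$ is a consequence) if $c$ occurs in some proof from $D$. Every logic contains $+\Delta$: append $+\Delta q$ if $q\in F$ or there is $r\in R_s[q]$ with $+\Delta a\in P$ for all $a\in A(r)$; and $-\Delta$: append $-\Delta q$ if $q\notin F$ and for every $r\in R_s[q]$ some $a\in A(r)$ has $-\Delta a\in P$. An inference rule is stable if for every proof $P$ and every proof $Q$ containing $P$ as a subsequence, $C(P)\rightarrow C(Q)$; a logic is stable if all its rules are. The rule $+d$ is consistent if for every defeasible theory $D$ and every proposition $q$, it is not the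 case that both $+d\,q$ and $+d\,\neg q$ are consequences of $D$ unless $+\Delta q$ and $+\Delta\neg q$ are also consequences of $D$. A formula $\psi(D,q,P)$ is proof-valid if it holds for every $D$, every literal $q$ and every proof $P$ from $D$. -}

module Defs where

open import Data.Nat using (ℕ)
open import Data.Fin using (Fin)
open import Data.List using (List; []; _∷_; _++_; [_])
open import Data.List.Membership.Propositional using (_∈_; _∉_)
open import Data.List.Relation.Unary.All using (All)
open import Data.List.Relation.Unary.Any using (Any)
open import Data.List.Relation.Binary.Sublist.Propositional using (_⊆_)
open import Data.Product using (_×_; Σ; ∃; ∃-syntax; _,_)
open import Data.Sum using (_⊎_)
open import Relation.Nullary using (¬_)
open import Relation.Binary.PropositionalEquality using (_≡_)

module DL (Atom : Set) (n : ℕ) where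

  data Literal : Set where
    pos : Atom → Literal
    neg : Atom → Literal

  ∼_ : Literal → Literal
  ∼ pos p = neg p
  ∼ neg p = pos p

  data RuleType : Set where
    strict defeasible defeater : RuleType

  record Rule : Set where
    constructor mkRule
    field
      antecedent : List Literal
      type       : RuleType
      consequent : Literal
  open Rule public

  data TC (S : List (Rule × Rule)) : Rule → Rule → Set where
    step  : ∀ {r s} → (r , s) ∈ S → TC S r s
    trans : ∀ {r s t} → (r , s) ∈ S → TC S s t → TC S r t

  record Theory : Set where
    constructor mkTheory
    field
      facts    : List Literal
      rules    : List Rule
      sup      : List (Rule × Rule)
      sup-onR  : All (λ { (r , s) → r ∈ rules × s ∈ rules }) sup
      acyclic  : ∀ r → ¬ TC sup r r
  open Theory public

  _∈Rs[_]_ : Rule → Literal → Theory → Set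
  r ∈Rs[ q ] D = r ∈ rules D × type r ≡ strict × consequent r ≡ q

  data Tag : Set where
    Δ  : Tag
    tg : Fin n → Tag

  data Sign : Set where
    + - : Sign

  record Conclusion : Set where
    constructor concl
    field
      sign : Sign
      tag  : Tag
      lit  : Literal

  Conditions : Set₁
  Conditions = Sign → Fin n → Theory → Literal → List Conclusion → Set

  C+Δ : Theory → Literal → List Conclusion → Set
  C+Δ D q P = q ∈ facts D
            ⊎ ∃[ r ] (r ∈Rs[ q ] D × All (λ a → concl + Δ a ∈ P) (antecedent r))

  C-Δ : Theory → Literal → List Conclusion → Set
  C-Δ D q P = q ∉ facts D
            × (∀ r → r ∈Rs[ q ] D → Any (λ a → concl - Δ a ∈ P) (antecedent r))

  Logic : Set₁
  Logic = Conditions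

  module _ (L : Logic) where

    Cond : Sign → Tag → Theory → Literal → List Conclusion → Set
    Cond + Δ      = C+Δ
    Cond - Δ      = C-Δ
    Cond s (tg t) = L s t

    Appendable : Theory → List Conclusion → Conclusion → Set
    Appendable D P (concl s t q) = Cond s t D q P

    data IsProof (D : Theory) : List Conclusion → Set where
      []   : IsProof D []
      _∷ʳ_ : ∀ {P c} → IsProof D P → Appendable D P c → IsProof D (P ++ [ c ])

    _⊢_ : Theory → Conclusion → Set
    D ⊢ c = ∃[ P ] (IsProof D P × c ∈ P)

    StableRule : Sign → Tag → Set
    StableRule s t = ∀ D q P Q → IsProof D P → IsProof D Q → P ⊆ Q →
                     Cond s t D q P → Cond s t D q Q

    Stable : Set
    Stable = ∀ s t → StableRule s t

    Consistent : Tag → Set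
    Consistent d = ∀ D (q : Atom) →
      D ⊢ concl + d (pos q) → D ⊢ concl + d (neg q) →
      (D ⊢ concl + Δ (pos q)) × (D ⊢ concl + Δ (neg q))

    ProofValid : (Theory → Literal → List Conclusion → Set) → Set
    ProofValid ψ = ∀ D q P → IsProof D P → ψ D q P

module Submission where

open import Defs
open import Data.Nat using (ℕ)
open import Data.Product using (_×_; _,_; ∃-syntax; proj₁; proj₂)
open import Data.Sum using (inj₁; inj₂)
open import Data.List using (_++_; [_])
open import Data.List.Properties using (++-assoc; ++-identityʳ)
open import Data.List.Membership.Propositional using (_∈_)
open import Data.List.Membership.Propositional.Properties using (∈-++⁻; ∈-++⁺ʳ)
open import Data.List.Relation.Unary.Any using (here)
open import Data.List.Relation.Binary.Sublist.Propositional using (_⊆_; ⊆-refl; ⊆-trans)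
open import Data.List.Relation.Binary.Sublist.Propositional.Properties using (++⁺ˡ; ++⁺ʳ)
open import Relation.Binary.PropositionalEquality using (refl; subst; sym)

-- Stability makes the conditions of the +d rules used to derive +d q and +d ¬q hold at
-- once on the concatenation of the two proofs, which is again a proof; there proof-validity
-- yields the conditions of +Δ q and +Δ ¬q, so both can be appended.

module _ {Atom : Set} {n : ℕ} where
  open DL Atom n

  module _ (L : Logic) {D : Theory} where

    ⊢-∷ʳ : ∀ {P c} → IsProof L D P → Appendable L D P c → _⊢_ L D c
    ⊢-∷ʳ {P} p a = P ++ [ _ ] , p ∷ʳ a , ∈-++⁺ʳ P (here refl)

    appended-to-subproof : ∀ {P c} → IsProof L D P → c ∈ P →
                           ∃[ P′ ] (IsProof L D P′ × P′ ⊆ P × Appendable L D P′ c)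
    appended-to-subproof (_∷ʳ_ {P} p a) c∈P++[c′] with ∈-++⁻ P c∈P++[c′]
    ... | inj₂ (here refl) = P , p , ++⁺ʳ _ ⊆-refl , a
    ... | inj₁ c∈P with appended-to-subproof p c∈P
    ...   | P′ , p′ , P′⊆P , a′ = P′ , p′ , ⊆-trans P′⊆P (++⁺ʳ _ ⊆-refl) , a′

    module _ (stable : Stable L) where

      appendable-mono : ∀ {P Q} c → IsProof L D P → IsProof L D Q → P ⊆ Q →
                        Appendable L D P c → Appendable L D Q c
      appendable-mono (concl s t q) = stable s t D q _ _

      ++-isProof : ∀ {P Q} → IsProof L D P → IsProof L D Q → IsProof L D (P ++ Q)
      ++-isProof {P} p [] = subst (IsProof L D) (sym (++-identityʳ P)) p
      ++-isProof {P} p (_∷ʳ_ {Q} {c} q a) =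
        subst (IsProof L D) (++-assoc P Q [ c ])
          (p++q ∷ʳ appendable-mono c q p++q (++⁺ˡ P ⊆-refl) a)
        where p++q = ++-isProof p q

      appendable-in-superproof : ∀ {P Q c} → IsProof L D P → IsProof L D Q → P ⊆ Q →
                                 c ∈ P → Appendable L D Q c
      appendable-in-superproof {c = c} p q P⊆Q c∈P with appended-to-subproof p c∈P
      ... | P′ , p′ , P′⊆P , a = appendable-mono c p′ q (⊆-trans P′⊆P P⊆Q) a

proposition9 : (Atom : Set) (n : ℕ) → let open DL Atom n in
    (L : Logic) (d : Tag) →
    Stable L →
    ProofValid L (λ D q P → Cond L + d D q P × Cond L + d D (∼ q) P →
                            C+Δ D q P × C+Δ D (∼ q) P) →
    Consistent L d
proposition9 Atom n L d stable valid D q (P , p , +dq∈P) (Q , p′ , +d¬q∈Q) =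
  ⊢-∷ʳ L pq (proj₁ +Δ-both) , ⊢-∷ʳ L pq (proj₂ +Δ-both)
  where
    open DL Atom n
    pq : IsProof L D (P ++ Q)
    pq = ++-isProof L stable p p′
    +Δ-both : C+Δ D (pos q) (P ++ Q) × C+Δ D (neg q) (P ++ Q)
    +Δ-both = valid D _ (P ++ Q) pq
      ( appendable-in-superproof L stable p pq (++⁺ʳ Q ⊆-refl) +dq∈P
      , appendable-in-superproof L stable p′ pq (++⁺ˡ P ⊆-refl) +d¬q∈Q )
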